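{- Let $\mathcal G$ be an embedded proper level-planar graph (containing the boundary paths $p_L,p_R$) and $\lambda\in\mathbb N$. If $D_{\mathcal G}^\lambda$ has a shortest distance labeling, then it describes the $\lambda$-rightmost drawing of $\mathcal G$ (i.e., interpreting the shortest distance labels as $x$-coordinates yields the $\lambda$-rightmost drawing).
   Context: A $k$-level graph is a directed graph $G=(V,E)$ with $\ell:V\to\{1,\dots,k\}$; proper means $\ell(v)=\ell(u)+1$ for every edge $(u,v)$. A level drawing places $v$ at $(\Gamma(v),\ell(v))$, edges as $y$-monotone curves; level-planar means no crossings except at common endpoints. An embedding is a left-to-right order of the vertices on each level (as induced by a level-planar drawing); an embedded level graph is a level graph with an embedding; vertices adjacent in a level's order are consecutive. Slope of $(u,v)$: $\Gamma(v)-\Gamma(u)$. A $\lambda$-drawing is a straight-line level-planar drawing inducing the given embedding with all slopes in $\{0,\dots,\lambda-1\}$. Standing convention: $\mathcal G$ contains a left boundary path $p_L$ and right boundary path $p_R$, each a directed path with one vertex on each level $1,\dots,k$, leftmost resp. rightmost on their levels; $n=|V|$; $v_R$ is the level-1 vertex of $p_R$. $D_{\mathcal G}^\lambda$: directed graph on vertex set $V$: for each edge $(u,w)$ of $\mathcal G$ an edge $(u,w)$ of length $\lambda-1$ and an edge $(w,u)$ of length $0$; for each consecutive pair $u,v$ on a level with $u$ left of $v$ an edge $(v,u)$ of length $-1$ and an edge $(u,v)$ of length $(\lambda-1)(n-1)$. A distance labeling is $x:V\to\mathbb Z$ with $x(b)\le x(a)+l$ for every edge $(a,b)$ of length $l$.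 The shortest distance labeling assigns to each vertex its shortest-path distance from $v_R$ in $D_{\mathcal G}^\lambda$ (when these distances are well defined). A $\lambda$-drawing $\Gamma$ of $\mathcal G$ with $\Gamma(v_R)=0$ is $\lambda$-rightmost if there is no $\lambda$-drawing $\Gamma'$ with $\Gamma'(v_R)=0$ and $\Gamma(v)<\Gamma'(v)$ for some vertex $v$. -}

module Defs where

open import Data.Nat using (ℕ; zero; suc) renaming (_≤_ to _≤ℕ_; _<_ to _<ℕ_)
open import Data.Integer using (ℤ; +_; -[1+_]; _+_; _-_; _*_; _≤_; _<_)
open import Data.Fin using (Fin)
open import Data.Product using (Σ; _×_; ∃; ∃-syntax)
open import Relation.Binary.PropositionalEquality using (_≡_)
open import Relation.Nullary using (¬_)

-- Vertices are Fin n (so n = |V|), levels are 1..k.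
-- The embedding (left-to-right order on each level) is given by a
-- position function  pos : vertices on the same level are ordered by pos.

record EmbeddedLevelGraph : Set₁ where
  field
    n     : ℕ
    k     : ℕ
    E     : Fin n → Fin n → Set
    ℓ     : Fin n → ℕ
    ℓ-≥1  : ∀ v → 1 ≤ℕ ℓ v
    ℓ-≤k  : ∀ v → ℓ v ≤ℕ k
    pos   : Fin n → ℕ
    pos-inj : ∀ u v → ℓ u ≡ ℓ v → pos u ≡ pos v → u ≡ v

  LeftOf : Fin n → Fin n → Set
  LeftOf u v = (ℓ u ≡ ℓ v) × (pos u <ℕ pos v)

  Consecutive : Fin n → Fin n → Set
  Consecutive u v = LeftOf u v × ¬ (∃[ w ] (LeftOf u w × LeftOf w v))

  -- a straight-line drawing with integer x-coordinates Γ (vertex v at (Γ v , ℓ v))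
  -- induces the embedding: on each level, left-to-right order is the embedding order
  Induces : (Fin n → ℤ) → Set
  Induces Γ = ∀ u v → LeftOf u v → Γ u < Γ v

  Crossing : (Fin n → ℤ) → Fin n → Fin n → Fin n → Fin n → Set
  Crossing Γ u v u' v' = (ℓ u ≡ ℓ u') × (Γ u < Γ u') × (Γ v' < Γ v)

  LevelPlanar : (Fin n → ℤ) → Set
  LevelPlanar Γ = ∀ u v u' v' → E u v → E u' v' → ¬ Crossing Γ u v u' v'

record ProperLevelPlanarGraph : Set₁ where
  field
    G : EmbeddedLevelGraph
  open EmbeddedLevelGraph G public
  field
    proper : ∀ u v → E u v → ℓ v ≡ suc (ℓ u)
    planar : ∃[ Γ ] (Induces Γ × LevelPlanar Γ)
    -- boundary paths, indexed by level (only levels 1..k matter)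
    pL pR : ℕ → Fin n
    pL-level : ∀ i → 1 ≤ℕ i → i ≤ℕ k → ℓ (pL i) ≡ i
    pR-level : ∀ i → 1 ≤ℕ i → i ≤ℕ k → ℓ (pR i) ≡ i
    pL-path  : ∀ i → 1 ≤ℕ i → i <ℕ k → E (pL i) (pL (suc i))
    pR-path  : ∀ i → 1 ≤ℕ i → i <ℕ k → E (pR i) (pR (suc i))
    pL-leftmost  : ∀ i → 1 ≤ℕ i → i ≤ℕ k → ∀ w → ℓ w ≡ i → pos (pL i) ≤ℕ pos w
    pR-rightmost : ∀ i → 1 ≤ℕ i → i ≤ℕ k → ∀ w → ℓ w ≡ i → pos w ≤ℕ pos (pR i)
    k≥1 : 1 ≤ℕ k

  vR : Fin n
  vR = pR 1

module _ (𝒢 : ProperLevelPlanarGraph) (λ' : ℕ) where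
  open ProperLevelPlanarGraph 𝒢

  λ-1 : ℤ
  λ-1 = + λ' - + 1

  bigLen : ℤ
  bigLen = λ-1 * (+ n - + 1)

  IsλDrawing : (Fin n → ℤ) → Set
  IsλDrawing Γ = Induces Γ × LevelPlanar Γ ×
                 (∀ u v → E u v → (+ 0 ≤ Γ v - Γ u) × (Γ v - Γ u ≤ λ-1))

  IsλRightmost : (Fin n → ℤ) → Set
  IsλRightmost Γ = IsλDrawing Γ × (Γ vR ≡ + 0) ×
    (∀ Γ' → IsλDrawing Γ' → Γ' vR ≡ + 0 → ¬ (∃[ v ] (Γ v < Γ' v)))

  -- edges of D_𝒢^λ, indexed by source, target and length
  data DEdge : Fin n → Fin n → ℤ → Set where
    fwd   : ∀ {u w} → E u w → DEdge u w λ-1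
    bwd   : ∀ {u w} → E u w → DEdge w u (+ 0)
    left  : ∀ {u v} → Consecutive u v → DEdge v u -[1+ 0 ]
    right : ∀ {u v} → Consecutive u v → DEdge u v bigLen

  data Walk : Fin n → Fin n → ℤ → Set where
    []  : ∀ {v} → Walk v v (+ 0)
    _∷_ : ∀ {a b c l m} → DEdge a b l → Walk b c m → Walk a c (l + m)

  IsShortestDistanceLabeling : (Fin n → ℤ) → Set
  IsShortestDistanceLabeling x =
    ∀ v → Walk vR v (x v) × (∀ m → Walk vR v m → x v ≤ m)

{-# OPTIONS --safe #-}
-- Shortest distances satisfy every constraint of D: the constraints of the edges of 𝒢 say
-- that all slopes lie in {0,…,λ-1}, those of consecutive pairs that x increases along each
-- level, and planarity of x follows because it induces the (planar) embedding.
-- Now let Γ be any λ-drawing with Γ vR = 0. Every edge of a shortest path from vR is tight,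
-- and every edge of D except the long ones (u,v) of length (λ-1)(n-1) is also a constraint
-- on Γ, so Γ ≤ x ≤-propagates along the path. At a long edge, Γ v ≤ (λ-1)(ℓ v - 1) since v
-- lies left of p_R; and x - (λ-1)ℓ drops by at most one per tight edge, so by pigeonhole on
-- its at most n values it exceeds -(λ-1) - n on every vertex, which together with the length
-- (λ-1)(n-1) of the long edge gives x v ≥ (λ-1)(ℓ v - 1) as well.
module Submission where

open import Defs
open import Data.Nat using (ℕ)
open import Data.Integer using (ℤ)
open import Data.Fin using (Fin)
open import Data.Product using (Σ; _×_; ∃; ∃-syntax)

open import Data.Nat as ℕ using (zero; suc; z≤n; s≤s)
import Data.Nat.Properties as ℕ
open import Data.Integer using (+_; -[1+_]; _+_; _-_; _*_; -_; _≤_; _<_; _≤?_; _<?_; +≤+; nonNegative)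
open import Data.Integer.Properties
open import Algebra.Properties.AbelianGroup +-0-abelianGroup using (∙-cancelˡ)
open import Data.Integer.Tactic.RingSolver using (solve-∀)
open import Data.Fin using (toℕ)
import Data.Fin.Properties as Fin
open import Data.Product using (_,_; proj₁; proj₂)
open import Data.Sum using (inj₁; inj₂)
open import Function using (_∘_; id)
open import Level using (0ℓ)
open import Relation.Binary.Core using (Rel)
open import Relation.Binary.Construct.Closure.ReflexiveTransitive using (Star; ε; _◅_; fold)
open import Relation.Binary.Definitions using (tri<; tri≈; tri>)
open import Relation.Binary.PropositionalEquality
open import Relation.Nullary using (¬_; Dec; yes; no; contradiction)
open import Relation.Nullary.Decidable using (_×-dec_)

≤-by-slack : ∀ {a b} d → + 0 ≤ d → b - a ≡ d → a ≤ b
≤-by-slack d 0≤d b-a≡d = 0≤i-j⇒j≤i (subst (+ 0 ≤_) (sym b-a≡d) 0≤d)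

infixl 6 _⊕_
_⊕_ : ∀ {p q} → + 0 ≤ p → + 0 ≤ q → + 0 ≤ p + q
_⊕_ = +-mono-≤

+-cancelʳ-≤ : ∀ {a b} c → a + c ≤ b + c → a ≤ b
+-cancelʳ-≤ {a} {b} c a+c≤b+c = ≤-by-slack _ (i≤j⇒0≤j-i a+c≤b+c) (eq a b c)
  where
  eq : ∀ a b c → b - a ≡ (b + c) - (a + c)
  eq = solve-∀

≤-propagate : ∀ {γa γb xa xb l} → γb ≤ γa + l → xa + l ≤ xb → γa ≤ xa → γb ≤ xb
≤-propagate γb≤γa+l xa+l≤xb γa≤xa = ≤-trans γb≤γa+l (≤-trans (+-monoˡ-≤ _ γa≤xa) xa+l≤xb)

1≤i*j⇒1≤i : ∀ i j → + 0 ≤ j → + 1 ≤ i * j → + 1 ≤ i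
1≤i*j⇒1≤i i (+ p) _ 1≤ij with + 1 ≤? i
... | yes 1≤i = 1≤i
... | no 1≰i = contradiction (≤-trans 1≤ij (*-monoʳ-≤-nonNeg (+ p) (i<j⇒i≤pred[j] (≰⇒> 1≰i))))
                             λ { (+≤+ ()) }

inhabited⇒0≤n-1 : ∀ {n} → Fin n → + 0 ≤ + n - + 1
inhabited⇒0≤n-1 {suc n} _ = +≤+ z≤n

image-excludes-interval : ∀ {n} (g : Fin n → ℤ) c →
  ¬ (∀ (i : Fin (suc n)) → ∃[ z ] g z ≡ c - + toℕ i)
image-excludes-interval {n} g c hit with Fin.pigeonhole (ℕ.n<1+n n) (proj₁ ∘ hit)
... | i , j , i<j , same-vertex = ℕ.<-irrefl (+-injective (neg-injective same-point)) i<j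
  where
  same-point : - + toℕ i ≡ - + toℕ j
  same-point = ∙-cancelˡ c _ _
    (trans (sym (proj₂ (hit i))) (trans (cong g same-vertex) (proj₂ (hit j))))

module _ {a ℓ} {A : Set a} {R : Rel A ℓ} (f : A → ℤ)
         (drop≤1 : ∀ {u v} → R u v → f u ≤ + 1 + f v) where

  star-intermediate-value : ∀ {u v} → Star R u v → ∀ t → f v ≤ t → t ≤ f u → ∃[ z ] f z ≡ t
  star-intermediate-value {u} ε t fv≤t t≤fu = u , ≤-antisym fv≤t t≤fu
  star-intermediate-value {u} (_◅_ {j = w} r rs) t fv≤t t≤fu with t ≤? f w
  ... | yes t≤fw = star-intermediate-value rs t fv≤t t≤fw
  ... | no t≰fw = u , ≤-antisym (≤-trans (drop≤1 r) (i<j⇒suc[i]≤j (≰⇒> t≰fw))) t≤fu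

descent-bound : ∀ {ℓ n} {R : Rel (Fin n) ℓ} (f : Fin n → ℤ) →
  (∀ {u v} → R u v → f u ≤ + 1 + f v) → ∀ {r u} → Star R r u → f r - + n < f u
descent-bound {n = n} f drop≤1 {r} {u} path with f r - + n <? f u
... | yes below = below
... | no not-below = contradiction attained (image-excludes-interval f (f r))
  where
  attained : ∀ (i : Fin (suc n)) → ∃[ z ] f z ≡ f r - + toℕ i
  attained i = star-intermediate-value f drop≤1 path _
    (≤-trans (≮⇒≥ not-below) (+-monoʳ-≤ (f r) (neg-mono-≤ (+≤+ (Fin.toℕ≤pred[n] i)))))
    (i≤j⇒i-k≤j (+ toℕ i) ≤-refl)

module _ (𝒢 : ProperLevelPlanarGraph) where
  open ProperLevelPlanarGraph 𝒢

  consecutive-increasing⇒induces : {Γ : Fin n → ℤ} →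
    (∀ {u v} → Consecutive u v → Γ u < Γ v) → Induces Γ
  consecutive-increasing⇒induces {Γ} step u v u◁v =
    within (pos v) u v (ℕ.m≤n+m (pos v) (pos u)) u◁v
    where
    leftOf? : ∀ u v → Dec (LeftOf u v)
    leftOf? u v = (ℓ u ℕ.≟ ℓ v) ×-dec (pos u ℕ.<? pos v)

    within : ∀ d u v → pos v ℕ.≤ pos u ℕ.+ d → LeftOf u v → Γ u < Γ v
    within zero u v gap (_ , lt) =
      contradiction (subst (pos v ℕ.≤_) (ℕ.+-identityʳ (pos u)) gap) (ℕ.<⇒≱ lt)
    within (suc d) u v gap u◁v with Fin.any? (λ w → leftOf? u w ×-dec leftOf? w v)
    ... | yes (w , u◁w , w◁v) = <-trans (within d u w gap-uw u◁w) (within d w v gap-wv w◁v)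
      where
      gap′ : pos v ℕ.≤ suc (pos u ℕ.+ d)
      gap′ = subst (pos v ℕ.≤_) (ℕ.+-suc (pos u) d) gap
      gap-uw : pos w ℕ.≤ pos u ℕ.+ d
      gap-uw = ℕ.≤-pred (ℕ.≤-trans (proj₂ w◁v) gap′)
      gap-wv : pos v ℕ.≤ pos w ℕ.+ d
      gap-wv = ℕ.≤-trans gap′ (ℕ.+-monoˡ-≤ d (proj₂ u◁w))
    ... | no nothing-between = step (u◁v , nothing-between)

  module _ {Γ : Fin n → ℤ} (induces : Induces Γ) where

    induces⇒≤ : ∀ {u v} → ℓ u ≡ ℓ v → pos u ℕ.≤ pos v → Γ u ≤ Γ v
    induces⇒≤ {u} {v} same-level pu≤pv with ℕ.m≤n⇒m<n∨m≡n pu≤pv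
    ... | inj₁ pu<pv = <⇒≤ (induces u v (same-level , pu<pv))
    ... | inj₂ pu≡pv = ≤-reflexive (cong Γ (pos-inj u v same-level pu≡pv))

    induces⇒pos-< : ∀ {u v} → ℓ u ≡ ℓ v → Γ u < Γ v → pos u ℕ.< pos v
    induces⇒pos-< {u} {v} same-level Γu<Γv with ℕ.<-cmp (pos u) (pos v)
    ... | tri< pu<pv _ _ = pu<pv
    ... | tri≈ _ pu≡pv _ = contradiction Γu<Γv (<-irrefl (cong Γ (pos-inj u v same-level pu≡pv)))
    ... | tri> _ _ pv<pu = contradiction Γu<Γv (<-asym (induces v u (sym same-level , pv<pu)))

    -- Edges between two levels cross exactly when their endpoints appear in opposite
    -- orders, and that depends only on the embedding, which some planar drawing induces.
    induces⇒levelPlanar : LevelPlanar Γ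
    induces⇒levelPlanar u v u′ v′ uv u′v′ (same-level , Γu<Γu′ , Γv′<Γv)
      with planar
    ... | Γ₀ , induces₀ , planar₀ =
      planar₀ u v u′ v′ uv u′v′
        (same-level , induces₀ u u′ (same-level , induces⇒pos-< same-level Γu<Γu′)
                    , induces₀ v′ v (same-level′ , induces⇒pos-< same-level′ Γv′<Γv))
      where
      same-level′ : ℓ v′ ≡ ℓ v
      same-level′ = trans (proper u′ v′ u′v′)
                          (trans (cong suc (sym same-level)) (sym (proper u v uv)))

module _ (𝒢 : ProperLevelPlanarGraph) (λ' : ℕ) where
  open ProperLevelPlanarGraph 𝒢

  private
    σ : ℤ
    σ = λ-1 𝒢 λ'

    B : ℤ
    B = bigLen 𝒢 λ'

    Walk′ : Fin n → Fin n → ℤ → Set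
    Walk′ = Walk 𝒢 λ'

    DEdge′ : Fin n → Fin n → ℤ → Set
    DEdge′ = DEdge 𝒢 λ'

  _∷ʳ_ : ∀ {a b c m l} → Walk′ a b m → DEdge′ b c l → Walk′ a c (m + l)
  _∷ʳ_ {l = l} [] e = subst (Walk′ _ _) (+-comm l (+ 0)) (e ∷ [])
  (_∷_ {l = l₁} {m = m₁} e w) ∷ʳ e′ = subst (Walk′ _ _) (sym (+-assoc l₁ m₁ _)) (e ∷ (w ∷ʳ e′))

  IsDistanceLabeling : (Fin n → ℤ) → Set
  IsDistanceLabeling x = ∀ {a b l} → DEdge′ a b l → x b ≤ x a + l

  TightEdge : (Fin n → ℤ) → Rel (Fin n) 0ℓ
  TightEdge x a b = ∃[ l ] (DEdge′ a b l × x a + l ≤ x b)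

  module _ {x : Fin n → ℤ} (distance : IsDistanceLabeling x) where

    distance-walk : ∀ {a v m} → Walk′ a v m → x v ≤ x a + m
    distance-walk {a} [] = ≤-reflexive (sym (+-identityʳ (x a)))
    distance-walk {a} {v} (_∷_ {b = b} {l = l} {m = m} e w) =
      ≤-by-slack _ (i≤j⇒0≤j-i (distance-walk w) ⊕ i≤j⇒0≤j-i (distance e)) (eq (x a) (x b) (x v) l m)
      where
      eq : ∀ xa xb xv l m → xa + (l + m) - xv ≡ (xb + m - xv) + (xa + l - xb)
      eq = solve-∀

    tighten : ∀ {a v m} → Walk′ a v m → x a + m ≤ x v → Star (TightEdge x) a v
    tighten [] _ = ε
    tighten {a} {v} (_∷_ {b = b} {l = l} {m = m} e w) attained =
      (l , e , edge-tight) ◅ tighten w rest-tight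
      where
      edge-tight : x a + l ≤ x b
      edge-tight = ≤-by-slack _ (i≤j⇒0≤j-i attained ⊕ i≤j⇒0≤j-i (distance-walk w))
                              (eq₁ (x a) (x b) (x v) l m)
        where
        eq₁ : ∀ xa xb xv l m → xb - (xa + l) ≡ (xv - (xa + (l + m))) + ((xb + m) - xv)
        eq₁ = solve-∀
      rest-tight : x b + m ≤ x v
      rest-tight = ≤-by-slack _ (i≤j⇒0≤j-i (distance e) ⊕ i≤j⇒0≤j-i attained)
                              (eq₂ (x a) (x b) (x v) l m)
        where
        eq₂ : ∀ xa xb xv l m → xv - (xb + m) ≡ ((xa + l) - xb) + (xv - (xa + (l + m)))
        eq₂ = solve-∀

    distance-consecutive-< : ∀ {u v} → Consecutive u v → x u < x v
    distance-consecutive-< {u} {v} c =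
      suc[i]≤j⇒i<j (≤-by-slack _ (i≤j⇒0≤j-i (distance (left c))) (eq (x u) (x v)))
      where
      eq : ∀ a b → b - (+ 1 + a) ≡ (b + - (+ 1)) - a
      eq = solve-∀

    distance-slopes : ∀ u v → E u v → (+ 0 ≤ x v - x u) × (x v - x u ≤ σ)
    distance-slopes u v e =
      i≤j⇒0≤j-i (subst (x u ≤_) (+-identityʳ (x v)) (distance (bwd e))) ,
      ≤-by-slack _ (i≤j⇒0≤j-i (distance (fwd e))) (eq (x u) (x v) σ)
      where
      eq : ∀ a b s → s - (b - a) ≡ (a + s) - b
      eq = solve-∀

    distance⇒λDrawing : IsλDrawing 𝒢 λ' x
    distance⇒λDrawing = induces , induces⇒levelPlanar 𝒢 induces , distance-slopes
      where
      induces : Induces x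
      induces = consecutive-increasing⇒induces 𝒢 distance-consecutive-<

  module _ {x : Fin n → ℤ} (shortest : IsShortestDistanceLabeling 𝒢 λ' x) where

    shortest⇒distance : IsDistanceLabeling x
    shortest⇒distance {a} e = proj₂ (shortest _) _ (proj₁ (shortest a) ∷ʳ e)

    shortest-root : x vR ≡ + 0
    shortest-root = ≤-antisym (proj₂ (shortest vR) _ [])
      (≤-by-slack _ (i≤j⇒0≤j-i (distance-walk shortest⇒distance (proj₁ (shortest vR)))) (eq (x vR)))
      where
      eq : ∀ y → y - + 0 ≡ y + y - y
      eq = solve-∀

    shortest-tight-path : ∀ v → Star (TightEdge x) vR v
    shortest-tight-path v = tighten shortest⇒distance (proj₁ (shortest v))
      (≤-reflexive (trans (cong (_+ x v) shortest-root) (+-identityˡ (x v))))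

    private
      f : Fin n → ℤ
      f w = x w - σ * + ℓ w

    tight-edge-drop≤1 : + 0 ≤ σ → + 0 ≤ B → ∀ {a b} → TightEdge x a b → f a ≤ + 1 + f b
    tight-edge-drop≤1 _ _ (_ , fwd {u} {w} e , tight) rewrite proper u w e =
      ≤-by-slack _ (i≤j⇒0≤j-i tight ⊕ +≤+ z≤n) (eq (x u) (x w) σ (+ ℓ u))
      where
      eq : ∀ xu xw s L → (+ 1 + (xw - s * (+ 1 + L))) - (xu - s * L) ≡ (xw - (xu + s)) + + 1
      eq = solve-∀
    tight-edge-drop≤1 0≤σ _ (_ , bwd {u} {w} e , tight) rewrite proper u w e =
      ≤-by-slack _ (i≤j⇒0≤j-i tight ⊕ 0≤σ ⊕ +≤+ z≤n) (eq (x u) (x w) σ (+ ℓ u))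
      where
      eq : ∀ xu xw s L → (+ 1 + (xu - s * L)) - (xw - s * (+ 1 + L)) ≡ (xu - (xw + + 0)) + s + + 1
      eq = solve-∀
    tight-edge-drop≤1 _ _ (_ , left {u} {v} c , tight) rewrite proj₁ (proj₁ c) =
      ≤-by-slack _ (i≤j⇒0≤j-i tight) (eq (x u) (x v) σ (+ ℓ v))
      where
      eq : ∀ xu xv s L → (+ 1 + (xu - s * L)) - (xv - s * L) ≡ xu - (xv + - (+ 1))
      eq = solve-∀
    tight-edge-drop≤1 _ 0≤B (_ , right {u} {v} c , tight) rewrite proj₁ (proj₁ c) =
      ≤-by-slack _ (i≤j⇒0≤j-i tight ⊕ 0≤B ⊕ +≤+ z≤n) (eq (x u) (x v) σ (+ ℓ v) B)
      where
      eq : ∀ xu xv s L b → (+ 1 + (xv - s * L)) - (xu - s * L) ≡ (xv - (xu + b)) + b + + 1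
      eq = solve-∀

    f-root : f vR ≡ - σ
    f-root rewrite shortest-root | pR-level 1 (s≤s z≤n) k≥1 = eq σ
      where
      eq : ∀ s → + 0 - s * + 1 ≡ - s
      eq = solve-∀

    -- A drawing need not respect the long edge u → v of D; instead its length B = σ(n-1)
    -- pushes x v up to the bound σ(ℓ v - 1) that every drawing obeys.
    shortest-right-target : ∀ {u v} → Consecutive u v → x u + B ≤ x v → σ * + ℓ v ≤ x v + σ
    shortest-right-target {u} {v} c tight rewrite sym (proj₁ (proj₁ c)) =
      ≤-by-slack _ (i≤j⇒0≤j-i tight ⊕ i≤j⇒0≤j-i n-1≤B ⊕ i≤j⇒0≤j-i (i<j⇒suc[i]≤j u-above))
        (eq (x u) (x v) σ (+ ℓ u) (+ n) B)
      where
      0≤n-1 : + 0 ≤ + n - + 1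
      0≤n-1 = inhabited⇒0≤n-1 u

      1≤B : + 1 ≤ B
      1≤B = ≤-by-slack _ (i≤j⇒0≤j-i (shortest⇒distance (right c)) ⊕ i≤j⇒0≤j-i (shortest⇒distance (left c)))
                         (eq′ (x u) (x v) B)
        where
        eq′ : ∀ xu xv b → b - + 1 ≡ (xu + b - xv) + (xv + - (+ 1) - xu)
        eq′ = solve-∀

      1≤σ : + 1 ≤ σ
      1≤σ = 1≤i*j⇒1≤i σ (+ n - + 1) 0≤n-1 1≤B

      n-1≤B : + n - + 1 ≤ B
      n-1≤B = subst (_≤ B) (*-identityˡ (+ n - + 1))
                    (*-monoʳ-≤-nonNeg (+ n - + 1) {{nonNegative 0≤n-1}} 1≤σ)

      u-above : - σ - + n < f u
      u-above = subst (λ r → r - + n < f u) f-root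
        (descent-bound f (tight-edge-drop≤1 (≤-trans (+≤+ z≤n) 1≤σ) (≤-trans 0≤n-1 n-1≤B))
                       (shortest-tight-path u))

      eq : ∀ xu xv s L N b → (xv + s) - s * L ≡
             (xv - (xu + b)) + (b - (N - + 1)) + ((xu - s * L) - (+ 1 + (- s - N)))
      eq = solve-∀

  module _ {Γ : Fin n → ℤ} (drawing : IsλDrawing 𝒢 λ' Γ) (Γ-root : Γ vR ≡ + 0) where

    private
      induces : Induces Γ
      induces = proj₁ drawing

      slopes : ∀ u v → E u v → (+ 0 ≤ Γ v - Γ u) × (Γ v - Γ u ≤ σ)
      slopes = proj₂ (proj₂ drawing)

    drawing-fwd : ∀ {u w} → E u w → Γ w ≤ Γ u + σ
    drawing-fwd {u} {w} e = ≤-by-slack _ (i≤j⇒0≤j-i (proj₂ (slopes u w e))) (eq (Γ u) (Γ w) σ)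
      where
      eq : ∀ a b s → (a + s) - b ≡ s - (b - a)
      eq = solve-∀

    drawing-bwd : ∀ {u w} → E u w → Γ u ≤ Γ w + + 0
    drawing-bwd {u} {w} e = subst (Γ u ≤_) (sym (+-identityʳ (Γ w))) (0≤i-j⇒j≤i (proj₁ (slopes u w e)))

    drawing-left : ∀ {u v} → Consecutive u v → Γ u ≤ Γ v + -[1+ 0 ]
    drawing-left {u} {v} c =
      ≤-by-slack _ (i≤j⇒0≤j-i (i<j⇒suc[i]≤j (induces u v (proj₁ c)))) (eq (Γ u) (Γ v))
      where
      eq : ∀ a b → (b + - (+ 1)) - a ≡ b - (+ 1 + a)
      eq = solve-∀

    drawing-right-boundary : ∀ i → 1 ℕ.≤ i → i ℕ.≤ k → Γ (pR i) + σ ≤ σ * + i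
    drawing-right-boundary 1 _ _ = ≤-reflexive (trans (cong (_+ σ) Γ-root) (eq σ))
      where
      eq : ∀ s → + 0 + s ≡ s * + 1
      eq = solve-∀
    drawing-right-boundary (suc (suc i)) _ i+2≤k =
      ≤-by-slack _ (i≤j⇒0≤j-i (drawing-fwd (pR-path (suc i) (s≤s z≤n) i+2≤k))
                   ⊕ i≤j⇒0≤j-i (drawing-right-boundary (suc i) (s≤s z≤n) (ℕ.<⇒≤ i+2≤k)))
        (eq (Γ (pR (suc (suc i)))) (Γ (pR (suc i))) σ (+ suc i))
      where
      eq : ∀ a b s I → s * (+ 1 + I) - (a + s) ≡ ((b + s) - a) + (s * I - (b + s))
      eq = solve-∀

    drawing-level-bound : ∀ w → Γ w + σ ≤ σ * + ℓ w
    drawing-level-bound w = ≤-trans (+-monoˡ-≤ σ left-of-boundary)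
                                    (drawing-right-boundary (ℓ w) (ℓ-≥1 w) (ℓ-≤k w))
      where
      left-of-boundary : Γ w ≤ Γ (pR (ℓ w))
      left-of-boundary = induces⇒≤ 𝒢 induces (sym (pR-level (ℓ w) (ℓ-≥1 w) (ℓ-≤k w)))
                                   (pR-rightmost (ℓ w) (ℓ-≥1 w) (ℓ-≤k w) w refl)

    module _ {x : Fin n → ℤ} (shortest : IsShortestDistanceLabeling 𝒢 λ' x) where

      tight-edge-preserves-≤ : ∀ {a b} → TightEdge x a b → Γ a ≤ x a → Γ b ≤ x b
      tight-edge-preserves-≤ (_ , fwd e , tight) = ≤-propagate (drawing-fwd e) tight
      tight-edge-preserves-≤ (_ , bwd e , tight) = ≤-propagate (drawing-bwd e) tight
      tight-edge-preserves-≤ (_ , left c , tight) = ≤-propagate (drawing-left c) tight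
      tight-edge-preserves-≤ (_ , right {v = v} c , tight) _ =
        +-cancelʳ-≤ σ (≤-trans (drawing-level-bound v) (shortest-right-target shortest c tight))

      drawing-≤-shortest : ∀ v → Γ v ≤ x v
      drawing-≤-shortest v =
        fold (λ a b → Γ a ≤ x a → Γ b ≤ x b) (λ e rest → rest ∘ tight-edge-preserves-≤ e) id
             (shortest-tight-path shortest v)
             (≤-reflexive (trans Γ-root (sym (shortest-root shortest))))

lemma5 : (𝒢 : ProperLevelPlanarGraph) (λ' : ℕ)
    (x : Fin (ProperLevelPlanarGraph.n 𝒢) → ℤ) →
    IsShortestDistanceLabeling 𝒢 λ' x → IsλRightmost 𝒢 λ' x
lemma5 𝒢 λ' x shortest =
  distance⇒λDrawing 𝒢 λ' (shortest⇒distance 𝒢 λ' shortest) ,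
  shortest-root 𝒢 λ' shortest ,
  λ Γ drawing Γ-root (v , xv<Γv) →
    <⇒≱ xv<Γv (drawing-≤-shortest 𝒢 λ' drawing Γ-root shortest v)
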